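{- Let $P(X),Q(X) \in \mathbb{S}^{\infty}[\mathbf{X}]$ and further $a,b,c \in \mathbb{S}^{\infty}[\mathbf{X}]$. Then, \begin{enumerate} \item $P(Q)' = P'(Q) \cdot Q'$ (chain rule), \item $P(a+b) = P(a) + P'(a+b) \cdot b$ (Taylor's theorem), \item $ac \le bc \;\implies\; P(a) c \le P(b) c$. \end{enumerate}
   Context: $\mathbb{S}^{\infty}[\mathbf{X}]$ is the semiring of generalized absorptive polynomials over a finite indeterminate set $\mathbf{X}$: a monomial is a map $m\colon\mathbf{X}\to\mathbb{N}\cup\{\infty\}$ (multiplication adds exponents); $m_1$ absorbs $m_2$ if $m_1(Y)\le m_2(Y)$ for all $Y$; elements are antichains of monomials w.r.t. absorption; $P+Q$ is the set of absorption-maximal monomials of $P\cup Q$, $P\cdot Q$ the set of maximal monomials among products $m_1m_2$; $0=\emptyset$, $1=\{$constant monomial$\}$. It is an absorptive ($1+a=1$), fully-continuous commutative semiring; $\le$ is the natural order ($a\le b$ iff $a+b=b$), and $a^\infty:=\inf_{n\in\mathbb{N}}a^n$ (infimum w.r.t. $\le$). For a fixed $X\in\mathbf{X}$, $P(X)$ indicates that $X$ may occur in $P$, $P(a)$ is the result of substituting $a$ for $X$, and the partial derivative $P'$ w.r.t. $X$ is defined inductively by $X'=1$, $Y'=0$ for $Y\neq X$, $(PQ)'=P'Q+PQ'$, $(P+Q)'=P'+Q'$, $(P^\infty)'=P^\infty\cdot P'$. -}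

module Defs where

open import Data.Nat using (ℕ; zero; suc) renaming (_+_ to _+ℕ_; _≤_ to _≤ℕ_)
open import Data.Fin using (Fin; _≟_)
open import Data.List using (List; []; _∷_; map; concatMap; _++_)
open import Data.List.Relation.Unary.All using (All)
open import Data.List.Relation.Unary.Any using (Any)
open import Data.Product using (_×_)
open import Data.Unit using (⊤)
open import Data.Empty using (⊥)
open import Relation.Nullary using (yes; no)

data ℕ∞ : Set where
  fin : ℕ → ℕ∞
  ∞   : ℕ∞

_+∞_ : ℕ∞ → ℕ∞ → ℕ∞
fin m +∞ fin n = fin (m +ℕ n)
fin _ +∞ ∞     = ∞
∞     +∞ _     = ∞

data _≤∞_ : ℕ∞ → ℕ∞ → Set where
  fin≤fin : ∀ {m n} → m ≤ℕ n → fin m ≤∞ fin n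
  _≤∞∞    : ∀ e → e ≤∞ ∞

Mon : ℕ → Set
Mon n = Fin n → ℕ∞

mon1 : ∀ {n} → Mon n
mon1 _ = fin 0

monVar : ∀ {n} → Fin n → Mon n
monVar Y Z with Z ≟ Y
... | yes _ = fin 1
... | no  _ = fin 0

_·m_ : ∀ {n} → Mon n → Mon n → Mon n
(m₁ ·m m₂) Y = m₁ Y +∞ m₂ Y

_Absorbs_ : ∀ {n} → Mon n → Mon n → Set
m₁ Absorbs m₂ = ∀ Y → m₁ Y ≤∞ m₂ Y

expInf : ℕ∞ → ℕ∞
expInf (fin zero)    = fin zero
expInf (fin (suc _)) = ∞
expInf ∞             = ∞

mon∞ : ∀ {n} → Mon n → Mon n
mon∞ m Y = expInf (m Y)

-- 𝕊∞[𝐗]: an element is represented by a finite list of monomials,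
-- standing for the antichain of its absorption-maximal monomials.
-- Two lists represent the same element iff every monomial of each is
-- absorbed by some monomial of the other.

S∞ : ℕ → Set
S∞ n = List (Mon n)

_≼_ : ∀ {n} → S∞ n → S∞ n → Set
P ≼ Q = All (λ m → Any (λ m' → m' Absorbs m) Q) P

infix 4 _≈_ _≤_
_≈_ : ∀ {n} → S∞ n → S∞ n → Set
P ≈ Q = (P ≼ Q) × (Q ≼ P)

𝟘 : ∀ {n} → S∞ n
𝟘 = []

𝟙 : ∀ {n} → S∞ n
𝟙 = mon1 ∷ []

varS : ∀ {n} → Fin n → S∞ n
varS Y = monVar Y ∷ []

infixl 6 _⊕_
infixl 7 _⊗_
_⊕_ : ∀ {n} → S∞ n → S∞ n → S∞ n
P ⊕ Q = P ++ Q

_⊗_ : ∀ {n} → S∞ n → S∞ n → S∞ n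
P ⊗ Q = concatMap (λ m₁ → map (m₁ ·m_) Q) P

-- a^∞ = inf_n a^n; in 𝕊∞[𝐗] this is the sum of the m^∞ for m in a
_^∞ : ∀ {n} → S∞ n → S∞ n
P ^∞ = map mon∞ P

_≤_ : ∀ {n} → S∞ n → S∞ n → Set
a ≤ b = a ⊕ b ≈ b

infixl 6 _+ₑ_
infixl 7 _*ₑ_
infix 8 _^∞ₑ
infix 8 _^∞

data Expr (n : ℕ) : Set where
  var  : Fin n → Expr n
  zero one : Expr n
  _+ₑ_ _*ₑ_ : Expr n → Expr n → Expr n
  _^∞ₑ : Expr n → Expr n

eval : ∀ {n} → (Fin n → S∞ n) → Expr n → S∞ n
eval ρ (var Y)   = ρ Y
eval ρ zero      = 𝟘
eval ρ one       = 𝟙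
eval ρ (P +ₑ Q)  = eval ρ P ⊕ eval ρ Q
eval ρ (P *ₑ Q)  = eval ρ P ⊗ eval ρ Q
eval ρ (P ^∞ₑ)   = eval ρ P ^∞

⟦_⟧ : ∀ {n} → Expr n → S∞ n
⟦ P ⟧ = eval varS P

_[_≔_] : ∀ {n} → Expr n → Fin n → S∞ n → S∞ n
P [ X ≔ a ] = eval (λ Y → upd Y) P
  where
  upd : _ → _
  upd Y with Y ≟ X
  ... | yes _ = a
  ... | no  _ = varS Y

substE : ∀ {n} → Fin n → Expr n → Expr n → Expr n
substE X Q (var Y) with Y ≟ X
... | yes _ = Q
... | no  _ = var Y
substE X Q zero     = zero
substE X Q one      = one
substE X Q (P +ₑ R) = substE X Q P +ₑ substE X Q R
substE X Q (P *ₑ R) = substE X Q P *ₑ substE X Q R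
substE X Q (P ^∞ₑ)  = substE X Q P ^∞ₑ

∂ : ∀ {n} → Fin n → Expr n → Expr n
∂ X (var Y) with Y ≟ X
... | yes _ = one
... | no  _ = zero
∂ X zero     = zero
∂ X one      = zero
∂ X (P +ₑ Q) = ∂ X P +ₑ ∂ X Q
∂ X (P *ₑ Q) = (∂ X P *ₑ Q) +ₑ (P *ₑ ∂ X Q)
∂ X (P ^∞ₑ)  = P ^∞ₑ *ₑ ∂ X P

{-# OPTIONS --safe #-}
-- Up to ≈, lists of monomials form a commutative semiring whose preorder ≼ is the natural
-- order, with ⊕ as join and P ⊗ Q ≼ P.  All three parts are proved for arbitrary assignments
-- by induction on the expression: each case of the chain rule is a semiring identity, and
-- the ^∞ case of Taylor's theorem uses (a ⊕ b)^∞ ≈ a^∞ ⊕ b^∞ and a^∞ ≼ a^∞ ⊗ a.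
-- The ^∞ case of monotonicity is the one combinatorial step.  Given m ∈ a and k ∈ c, choose
-- k₁ ∈ c maximal above k for the preorder "m^∞ k₁ absorbs m^∞ k".  The hypothesis yields
-- v ∈ b and k₂ ∈ c with v k₂ absorbing m k₁; then m^∞ k₂ absorbs m^∞ k₁, so by maximality
-- the two are equivalent and v (m^∞ k₂) absorbs m^∞ k₂.  This forces v to vanish wherever
-- m^∞ k₂ has a finite exponent, so v^∞ k₂ absorbs m^∞ k₂ and hence m^∞ k.

module Submission where

open import Defs
open import Data.Nat using (ℕ; zero; suc; z≤n)
import Data.Nat.Properties as ℕ
open import Data.Fin using (Fin; _≟_)
open import Data.List using ([]; _∷_; map; _++_; cartesianProductWith)
open import Data.List.Properties using (++-assoc; map-++; cartesianProductWith-distribʳ-++)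
open import Data.List.Relation.Unary.All as All using (All)
import Data.List.Relation.Unary.All.Properties as All
open import Data.List.Relation.Unary.Any using (here; there)
open import Data.List.Membership.Propositional using (_∈_; find; lose)
open import Data.List.Membership.Propositional.Properties
  using (∈-++⁺ˡ; ∈-++⁺ʳ; ∈-map⁺; ∈-map⁻; ∈-cartesianProductWith⁺; ∈-cartesianProductWith⁻)
open import Data.List.Relation.Binary.Subset.Propositional.Properties
  using (⊆-refl; xs⊆x∷xs; ∷⁺ʳ; ∈-∷⁺ʳ)
open import Data.Product using (_×_; _,_; proj₁; ∃; ∃₂)
import Data.Vec.Functional.Relation.Binary.Pointwise.Properties as Pointwise
open import Function using (_∘_; flip; case_of_)
open import Relation.Nullary using (yes; no; contradiction)
open import Relation.Binary.Core using (Rel; _⇒_)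
open import Relation.Binary.Definitions using (Reflexive; Transitive; Decidable)
open import Relation.Binary.Bundles using (Preorder; Poset)
import Relation.Binary.Reasoning.Preorder as PreorderReasoning
import Relation.Binary.Reasoning.PartialOrder as PosetReasoning
open import Relation.Binary.PropositionalEquality as ≡
  using (_≡_; _≗_; refl; sym; cong; cong₂; module ≡-Reasoning)
open import Algebra.Bundles using (CommutativeMonoid; CommutativeSemiring)
open import Algebra.Structures.Biased using (isCommutativeMonoidˡ; isCommutativeSemiringˡ)
import Algebra.Construct.Pointwise as PointwiseAlgebra
import Algebra.Properties.CommutativeSemigroup as CommutativeSemigroupProperties

module _ {a ℓ} {A : Set a} {_≲_ : Rel A ℓ}
         (≲-refl : Reflexive _≲_) (≲-trans : Transitive _≲_) (_≲?_ : Decidable _≲_) where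

  maximal-above : ∀ x xs →
    ∃ λ y → y ∈ x ∷ xs × x ≲ y × (∀ {z} → z ∈ xs → y ≲ z → z ≲ y)
  maximal-above x [] = x , here refl , ≲-refl , λ ()
  maximal-above x (z ∷ zs) with x ≲? z
  ... | yes x≲z =
    let (y , y∈ , z≲y , maximal) = maximal-above z zs in
    y , there y∈ , ≲-trans x≲z z≲y , λ { (here refl) _ → z≲y ; (there w∈) → maximal w∈ }
  ... | no x≴z =
    let (y , y∈ , x≲y , maximal) = maximal-above x zs in
    y , ∷⁺ʳ x (xs⊆x∷xs zs z) y∈ , x≲y ,
    λ { (here refl) y≲z → contradiction (≲-trans x≲y y≲z) x≴z ; (there w∈) → maximal w∈ }

≤∞-refl : Reflexive _≤∞_
≤∞-refl {fin n} = fin≤fin ℕ.≤-refl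
≤∞-refl {∞}     = ∞ ≤∞∞

≤∞-reflexive : _≡_ ⇒ _≤∞_
≤∞-reflexive refl = ≤∞-refl

≤∞-trans : Transitive _≤∞_
≤∞-trans (fin≤fin p) (fin≤fin q) = fin≤fin (ℕ.≤-trans p q)
≤∞-trans _           (_ ≤∞∞)     = _ ≤∞∞

_≤∞?_ : Decidable _≤∞_
fin m ≤∞? fin n with m ℕ.≤? n
... | yes m≤n = yes (fin≤fin m≤n)
... | no  m≰n = no λ { (fin≤fin m≤n) → m≰n m≤n }
∞     ≤∞? fin n = no λ ()
e     ≤∞? ∞     = yes (e ≤∞∞)

fin0≤∞ : ∀ e → fin 0 ≤∞ e
fin0≤∞ (fin n) = fin≤fin z≤n
fin0≤∞ ∞       = fin 0 ≤∞∞

+∞-mono-≤∞ : ∀ {d d' e e'} → d ≤∞ d' → e ≤∞ e' → (d +∞ e) ≤∞ (d' +∞ e')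
+∞-mono-≤∞ (fin≤fin p) (fin≤fin q) = fin≤fin (ℕ.+-mono-≤ p q)
+∞-mono-≤∞ (fin≤fin p) (_ ≤∞∞)     = _ ≤∞∞
+∞-mono-≤∞ (_ ≤∞∞)     _           = _ ≤∞∞

+∞-commutativeMonoid : CommutativeMonoid _ _
+∞-commutativeMonoid = record
  { Carrier             = ℕ∞
  ; _≈_                 = _≡_
  ; _∙_                 = _+∞_
  ; ε                   = fin 0
  ; isCommutativeMonoid = isCommutativeMonoidˡ record
    { isSemigroup = record
      { isMagma = record { isEquivalence = ≡.isEquivalence ; ∙-cong = cong₂ _+∞_ }
      ; assoc   = assoc
      }
    ; identityˡ = identityˡ
    ; comm      = comm
    }
  }
  where
  assoc : ∀ d e f → (d +∞ e) +∞ f ≡ d +∞ (e +∞ f)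
  assoc (fin l) (fin m) (fin n) = cong fin (ℕ.+-assoc l m n)
  assoc (fin l) (fin m) ∞       = refl
  assoc (fin l) ∞       f       = refl
  assoc ∞       e       f       = refl

  identityˡ : ∀ e → fin 0 +∞ e ≡ e
  identityˡ (fin n) = refl
  identityˡ ∞       = refl

  comm : ∀ d e → d +∞ e ≡ e +∞ d
  comm (fin m) (fin n) = cong fin (ℕ.+-comm m n)
  comm (fin m) ∞       = refl
  comm ∞       (fin n) = refl
  comm ∞       ∞       = refl

expInf-+∞-self : ∀ e → expInf e +∞ e ≡ expInf e
expInf-+∞-self (fin zero)    = refl
expInf-+∞-self (fin (suc n)) = refl
expInf-+∞-self ∞             = refl

expInf-+∞-stable : ∀ v x → (v +∞ x) ≤∞ x → (expInf v +∞ x) ≤∞ x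
expInf-+∞-stable (fin zero)    x       v+x≤x       = v+x≤x
expInf-+∞-stable (fin (suc j)) (fin k) (fin≤fin p) = contradiction p (ℕ.m+n≮n j k)
expInf-+∞-stable (fin (suc j)) ∞       _           = ∞ ≤∞∞
expInf-+∞-stable ∞             ∞       _           = ∞ ≤∞∞

module _ {n : ℕ} where

  ·m-commutativeMonoid : CommutativeMonoid _ _
  ·m-commutativeMonoid = PointwiseAlgebra.commutativeMonoid (Fin n) +∞-commutativeMonoid

  open CommutativeMonoid ·m-commutativeMonoid public
    using () renaming (comm to ·m-comm; assoc to ·m-assoc; identityˡ to ·m-identityˡ;
                       ∙-congʳ to ·m-congʳ)

  private
    module ·m = CommutativeSemigroupProperties
      (CommutativeMonoid.commutativeSemigroup ·m-commutativeMonoid)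

  absorbs-preorder : Preorder _ _ _
  absorbs-preorder = record
    { Carrier    = Mon n
    ; _≈_        = _≗_
    ; _≲_        = _Absorbs_
    ; isPreorder = record
      { isEquivalence = CommutativeMonoid.isEquivalence ·m-commutativeMonoid
      ; reflexive     = λ m≗m' Y → ≤∞-reflexive (m≗m' Y)
      ; trans         = λ p q Y → ≤∞-trans (p Y) (q Y)
      }
    }

  open Preorder absorbs-preorder public
    using () renaming (refl to Absorbs-refl; reflexive to Absorbs-reflexive; trans to Absorbs-trans)

  _Absorbs?_ : Decidable (_Absorbs_ {n})
  _Absorbs?_ = Pointwise.decidable _≤∞?_

  ·m-mono : ∀ {m₁ m₁' m₂ m₂' : Mon n} →
            m₁ Absorbs m₁' → m₂ Absorbs m₂' → (m₁ ·m m₂) Absorbs (m₁' ·m m₂')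
  ·m-mono p q Y = +∞-mono-≤∞ (p Y) (q Y)

  m₂-absorbs-m₁·m₂ : (m₁ m₂ : Mon n) → m₂ Absorbs (m₁ ·m m₂)
  m₂-absorbs-m₁·m₂ m₁ m₂ = begin
    m₂          ≈⟨ ·m-identityˡ m₂ ⟨
    mon1 ·m m₂  ≲⟨ ·m-mono (λ Y → fin0≤∞ (m₁ Y)) Absorbs-refl ⟩
    m₁ ·m m₂    ∎
    where open PreorderReasoning absorbs-preorder

  mon∞-·m-self : (m : Mon n) → mon∞ m ·m m ≗ mon∞ m
  mon∞-·m-self m Y = expInf-+∞-self (m Y)

  mon∞-stable : (v x : Mon n) → (v ·m x) Absorbs x → (mon∞ v ·m x) Absorbs x
  mon∞-stable v x vx≤x Y = expInf-+∞-stable (v Y) (x Y) (vx≤x Y)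

  mon∞-·m-mono : ∀ m {v k₁ k₂ : Mon n} → (v ·m k₂) Absorbs (m ·m k₁) →
                 (mon∞ m ·m (v ·m k₂)) Absorbs (mon∞ m ·m k₁)
  mon∞-·m-mono m {v} {k₁} {k₂} vk₂-absorbs-mk₁ = begin
    mon∞ m ·m (v ·m k₂)  ≲⟨ ·m-mono Absorbs-refl vk₂-absorbs-mk₁ ⟩
    mon∞ m ·m (m ·m k₁)  ≈⟨ ·m-assoc (mon∞ m) m k₁ ⟨
    (mon∞ m ·m m) ·m k₁  ≈⟨ ·m-congʳ (mon∞-·m-self m) ⟩
    mon∞ m ·m k₁         ∎
    where open PreorderReasoning absorbs-preorder

  mon∞-·m-gain : ∀ m {v k₁ k₂ : Mon n} → (v ·m k₂) Absorbs (m ·m k₁) →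
                 (mon∞ m ·m k₂) Absorbs (mon∞ m ·m k₁)
  mon∞-·m-gain m {v} {k₁} {k₂} vk₂-absorbs-mk₁ =
    Absorbs-trans (·m-mono Absorbs-refl (m₂-absorbs-m₁·m₂ v k₂)) (mon∞-·m-mono m vk₂-absorbs-mk₁)

  mon∞-transfer : ∀ m {v k₁ k₂ : Mon n} → (v ·m k₂) Absorbs (m ·m k₁) →
                  (mon∞ m ·m k₁) Absorbs (mon∞ m ·m k₂) →
                  (mon∞ v ·m k₂) Absorbs (mon∞ m ·m k₁)
  mon∞-transfer m {v} {k₁} {k₂} vk₂-absorbs-mk₁ k₁-absorbs-k₂ = begin
    mon∞ v ·m k₂              ≲⟨ ·m-mono Absorbs-refl (m₂-absorbs-m₁·m₂ (mon∞ m) k₂) ⟩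
    mon∞ v ·m (mon∞ m ·m k₂)  ≲⟨ mon∞-stable v (mon∞ m ·m k₂) v-stable ⟩
    mon∞ m ·m k₂              ≲⟨ mon∞-·m-gain m vk₂-absorbs-mk₁ ⟩
    mon∞ m ·m k₁              ∎
    where
    open PreorderReasoning absorbs-preorder
    v-stable : (v ·m (mon∞ m ·m k₂)) Absorbs (mon∞ m ·m k₂)
    v-stable = begin
      v ·m (mon∞ m ·m k₂)  ≈⟨ ·m.x∙yz≈y∙xz v (mon∞ m) k₂ ⟩
      mon∞ m ·m (v ·m k₂)  ≲⟨ mon∞-·m-mono m vk₂-absorbs-mk₁ ⟩
      mon∞ m ·m k₁         ≲⟨ k₁-absorbs-k₂ ⟩
      mon∞ m ·m k₂         ∎

module _ {n : ℕ} where

  ≼-intro : {P Q : S∞ n} → (∀ {m} → m ∈ P → ∃ λ m' → m' ∈ Q × m' Absorbs m) → P ≼ Q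
  ≼-intro h = All.tabulate λ m∈ → let (m' , m'∈ , m'-absorbs-m) = h m∈ in lose m'∈ m'-absorbs-m

  ≼-elim : {P Q : S∞ n} → P ≼ Q → ∀ {m} → m ∈ P → ∃ λ m' → m' ∈ Q × m' Absorbs m
  ≼-elim P≼Q m∈ = find (All.lookup P≼Q m∈)

  ≼-refl : {P : S∞ n} → P ≼ P
  ≼-refl = ≼-intro λ m∈ → _ , m∈ , Absorbs-refl

  ≼-trans : {P Q R : S∞ n} → P ≼ Q → Q ≼ R → P ≼ R
  ≼-trans P≼Q Q≼R = ≼-intro λ m∈ →
    let (m' , m'∈ , m'-absorbs-m) = ≼-elim P≼Q m∈
        (m'' , m''∈ , m''-absorbs-m') = ≼-elim Q≼R m'∈
    in m'' , m''∈ , Absorbs-trans m''-absorbs-m' m'-absorbs-m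

  ≼-poset : Poset _ _ _
  ≼-poset = record
    { Carrier        = S∞ n
    ; _≈_            = _≈_
    ; _≤_            = _≼_
    ; isPartialOrder = record
      { isPreorder = record
        { isEquivalence = record
          { refl  = ≼-refl , ≼-refl
          ; sym   = λ (P≼Q , Q≼P) → Q≼P , P≼Q
          ; trans = λ (P≼Q , Q≼P) (Q≼R , R≼Q) → ≼-trans P≼Q Q≼R , ≼-trans R≼Q Q≼P
          }
        ; reflexive = proj₁
        ; trans     = ≼-trans
        }
      ; antisym = _,_
      }
    }

  open Poset ≼-poset public using (module Eq)

  x≼x⊕y : (P Q : S∞ n) → P ≼ (P ⊕ Q)
  x≼x⊕y P Q = ≼-intro λ m∈ → _ , ∈-++⁺ˡ m∈ , Absorbs-refl

  y≼x⊕y : (P Q : S∞ n) → Q ≼ (P ⊕ Q)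
  y≼x⊕y P Q = ≼-intro λ m∈ → _ , ∈-++⁺ʳ P m∈ , Absorbs-refl

  ⊕-lub : {P Q R : S∞ n} → P ≼ R → Q ≼ R → (P ⊕ Q) ≼ R
  ⊕-lub = All.++⁺

  ⊕-mono : {P P' Q Q' : S∞ n} → P ≼ P' → Q ≼ Q' → (P ⊕ Q) ≼ (P' ⊕ Q')
  ⊕-mono {P' = P'} {Q' = Q'} P≼P' Q≼Q' =
    ⊕-lub (≼-trans P≼P' (x≼x⊕y P' Q')) (≼-trans Q≼Q' (y≼x⊕y P' Q'))

  ⊕-cong : {P P' Q Q' : S∞ n} → P ≈ P' → Q ≈ Q' → P ⊕ Q ≈ P' ⊕ Q'
  ⊕-cong (P≼P' , P'≼P) (Q≼Q' , Q'≼Q) = ⊕-mono P≼P' Q≼Q' , ⊕-mono P'≼P Q'≼Q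

  ⊕-monoˡ : (Q : S∞ n) {P P' : S∞ n} → P ≼ P' → (P ⊕ Q) ≼ (P' ⊕ Q)
  ⊕-monoˡ Q P≼P' = ⊕-mono P≼P' (≼-refl {Q})

  ⊕-monoʳ : (P : S∞ n) {Q Q' : S∞ n} → Q ≼ Q' → (P ⊕ Q) ≼ (P ⊕ Q')
  ⊕-monoʳ P = ⊕-mono (≼-refl {P})

  ⊕-congˡ : (P : S∞ n) {Q Q' : S∞ n} → Q ≈ Q' → P ⊕ Q ≈ P ⊕ Q'
  ⊕-congˡ P = ⊕-cong (Eq.refl {P})

  ⊕-congʳ : (Q : S∞ n) {P P' : S∞ n} → P ≈ P' → P ⊕ Q ≈ P' ⊕ Q
  ⊕-congʳ Q P≈P' = ⊕-cong P≈P' (Eq.refl {Q})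

  ⊕-comm : (P Q : S∞ n) → P ⊕ Q ≈ Q ⊕ P
  ⊕-comm P Q = ⊕-lub (y≼x⊕y Q P) (x≼x⊕y Q P) , ⊕-lub (y≼x⊕y P Q) (x≼x⊕y P Q)

  ≈⊕⇒≼ˡ : (A T : S∞ n) {S : S∞ n} → S ≈ A ⊕ T → A ≼ S
  ≈⊕⇒≼ˡ A T (_ , A⊕T≼S) = ≼-trans (x≼x⊕y A T) A⊕T≼S

  ≈⊕⇒≼ʳ : (A T : S∞ n) {S : S∞ n} → S ≈ A ⊕ T → T ≼ S
  ≈⊕⇒≼ʳ A T (_ , A⊕T≼S) = ≼-trans (y≼x⊕y A T) A⊕T≼S

  ≼⇒≤ : {P Q : S∞ n} → P ≼ Q → P ≤ Q
  ≼⇒≤ {P} {Q} P≼Q = ⊕-lub P≼Q ≼-refl , y≼x⊕y P Q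

  ≤⇒≼ : {P Q : S∞ n} → P ≤ Q → P ≼ Q
  ≤⇒≼ {P} {Q} (P⊕Q≼Q , _) = ≼-trans (x≼x⊕y P Q) P⊕Q≼Q

  ⊗-as-product : (P Q : S∞ n) → P ⊗ Q ≡ cartesianProductWith _·m_ P Q
  ⊗-as-product []      Q = refl
  ⊗-as-product (m ∷ P) Q = cong (map (m ·m_) Q ++_) (⊗-as-product P Q)

  ∈-⊗⁺ : {P Q : S∞ n} {m₁ m₂ : Mon n} → m₁ ∈ P → m₂ ∈ Q → m₁ ·m m₂ ∈ P ⊗ Q
  ∈-⊗⁺ {P} {Q} m₁∈ m₂∈ rewrite ⊗-as-product P Q = ∈-cartesianProductWith⁺ _·m_ m₁∈ m₂∈

  ∈-⊗⁻ : (P Q : S∞ n) {m : Mon n} → m ∈ P ⊗ Q →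
         ∃₂ λ m₁ m₂ → m₁ ∈ P × m₂ ∈ Q × m ≡ m₁ ·m m₂
  ∈-⊗⁻ P Q m∈ rewrite ⊗-as-product P Q = ∈-cartesianProductWith⁻ _·m_ P Q m∈

  ⊗-≼-intro : (P Q : S∞ n) {R : S∞ n} →
    (∀ {m₁ m₂} → m₁ ∈ P → m₂ ∈ Q → ∃ λ m → m ∈ R × m Absorbs (m₁ ·m m₂)) → (P ⊗ Q) ≼ R
  ⊗-≼-intro P Q h = ≼-intro λ m∈ →
    case ∈-⊗⁻ P Q m∈ of λ { (_ , _ , m₁∈ , m₂∈ , refl) → h m₁∈ m₂∈ }

  ⊗-mono : {P P' Q Q' : S∞ n} → P ≼ P' → Q ≼ Q' → (P ⊗ Q) ≼ (P' ⊗ Q')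
  ⊗-mono {P} {Q = Q} P≼P' Q≼Q' = ⊗-≼-intro P Q λ m₁∈ m₂∈ →
    let (m₁' , m₁'∈ , m₁'-absorbs-m₁) = ≼-elim P≼P' m₁∈
        (m₂' , m₂'∈ , m₂'-absorbs-m₂) = ≼-elim Q≼Q' m₂∈
    in m₁' ·m m₂' , ∈-⊗⁺ m₁'∈ m₂'∈ , ·m-mono m₁'-absorbs-m₁ m₂'-absorbs-m₂

  ⊗-monoˡ : (Q : S∞ n) {P P' : S∞ n} → P ≼ P' → (P ⊗ Q) ≼ (P' ⊗ Q)
  ⊗-monoˡ Q P≼P' = ⊗-mono P≼P' (≼-refl {Q})

  ⊗-monoʳ : (P : S∞ n) {Q Q' : S∞ n} → Q ≼ Q' → (P ⊗ Q) ≼ (P ⊗ Q')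
  ⊗-monoʳ P = ⊗-mono (≼-refl {P})

  ⊗-cong : {P P' Q Q' : S∞ n} → P ≈ P' → Q ≈ Q' → P ⊗ Q ≈ P' ⊗ Q'
  ⊗-cong (P≼P' , P'≼P) (Q≼Q' , Q'≼Q) = ⊗-mono P≼P' Q≼Q' , ⊗-mono P'≼P Q'≼Q

  ⊗-congˡ : (P : S∞ n) {Q Q' : S∞ n} → Q ≈ Q' → P ⊗ Q ≈ P ⊗ Q'
  ⊗-congˡ P = ⊗-cong (Eq.refl {P})

  ⊗-congʳ : (Q : S∞ n) {P P' : S∞ n} → P ≈ P' → P ⊗ Q ≈ P' ⊗ Q
  ⊗-congʳ Q P≈P' = ⊗-cong P≈P' (Eq.refl {Q})

  ⊗-comm : (P Q : S∞ n) → P ⊗ Q ≈ Q ⊗ P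
  ⊗-comm P Q = swap P Q , swap Q P
    where
    swap : ∀ P Q → (P ⊗ Q) ≼ (Q ⊗ P)
    swap P Q = ⊗-≼-intro P Q λ {m₁} {m₂} m₁∈ m₂∈ →
      m₂ ·m m₁ , ∈-⊗⁺ m₂∈ m₁∈ , Absorbs-reflexive (·m-comm m₂ m₁)

  ⊗-assoc : (P Q R : S∞ n) → (P ⊗ Q) ⊗ R ≈ P ⊗ (Q ⊗ R)
  ⊗-assoc P Q R = ⊗-≼-intro (P ⊗ Q) R rightward , ⊗-≼-intro P (Q ⊗ R) leftward
    where
    rightward : ∀ {m m₃} → m ∈ P ⊗ Q → m₃ ∈ R →
                ∃ λ m' → m' ∈ P ⊗ (Q ⊗ R) × m' Absorbs (m ·m m₃)
    rightward {m₃ = m₃} m∈ m₃∈ = case ∈-⊗⁻ P Q m∈ of λ { (m₁ , m₂ , m₁∈ , m₂∈ , refl) →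
      m₁ ·m (m₂ ·m m₃) , ∈-⊗⁺ m₁∈ (∈-⊗⁺ m₂∈ m₃∈) , Absorbs-reflexive (sym ∘ ·m-assoc m₁ m₂ m₃) }
    leftward : ∀ {m₁ m} → m₁ ∈ P → m ∈ Q ⊗ R →
               ∃ λ m' → m' ∈ (P ⊗ Q) ⊗ R × m' Absorbs (m₁ ·m m)
    leftward {m₁ = m₁} m₁∈ m∈ = case ∈-⊗⁻ Q R m∈ of λ { (m₂ , m₃ , m₂∈ , m₃∈ , refl) →
      (m₁ ·m m₂) ·m m₃ , ∈-⊗⁺ (∈-⊗⁺ m₁∈ m₂∈) m₃∈ , Absorbs-reflexive (·m-assoc m₁ m₂ m₃) }

  ⊗-identityˡ : (P : S∞ n) → 𝟙 ⊗ P ≈ P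
  ⊗-identityˡ P =
    ⊗-≼-intro 𝟙 P (λ { (here refl) m∈ → _ , m∈ , Absorbs-reflexive (sym ∘ ·m-identityˡ _)
                     ; (there ()) }) ,
    ≼-intro λ m∈ → _ , ∈-⊗⁺ {P = 𝟙} (here refl) m∈ , Absorbs-reflexive (·m-identityˡ _)

  ⊗-distribʳ-⊕ : (R P Q : S∞ n) → (P ⊕ Q) ⊗ R ≈ P ⊗ R ⊕ Q ⊗ R
  ⊗-distribʳ-⊕ R P Q = Eq.reflexive (begin
    (P ++ Q) ⊗ R                          ≡⟨ ⊗-as-product (P ++ Q) R ⟩
    cartesianProductWith _·m_ (P ++ Q) R  ≡⟨ cartesianProductWith-distribʳ-++ _·m_ P Q R ⟩
    cartesianProductWith _·m_ P R ++ cartesianProductWith _·m_ Q R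
                                          ≡⟨ cong₂ _++_ (⊗-as-product P R) (⊗-as-product Q R) ⟨
    P ⊗ R ++ Q ⊗ R                        ∎)
    where open ≡-Reasoning

  S∞-commutativeSemiring : CommutativeSemiring _ _
  S∞-commutativeSemiring = record
    { Carrier               = S∞ n
    ; _≈_                   = _≈_
    ; _+_                   = _⊕_
    ; _*_                   = _⊗_
    ; 0#                    = 𝟘
    ; 1#                    = 𝟙
    ; isCommutativeSemiring = isCommutativeSemiringˡ record
      { +-isCommutativeMonoid = isCommutativeMonoidˡ record
        { isSemigroup = record
          { isMagma = record { isEquivalence = Eq.isEquivalence ; ∙-cong = ⊕-cong }
          ; assoc   = λ P Q R → Eq.reflexive (++-assoc P Q R)
          }
        ; identityˡ = λ _ → Eq.refl
        ; comm      = ⊕-comm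
        }
      ; *-isCommutativeMonoid = isCommutativeMonoidˡ record
        { isSemigroup = record
          { isMagma = record { isEquivalence = Eq.isEquivalence ; ∙-cong = ⊗-cong }
          ; assoc   = ⊗-assoc
          }
        ; identityˡ = ⊗-identityˡ
        ; comm      = ⊗-comm
        }
      ; distribʳ = ⊗-distribʳ-⊕
      ; zeroˡ    = λ _ → Eq.refl
      }
    }

  open CommutativeSemiring S∞-commutativeSemiring public
    using () renaming (distribˡ to ⊗-distribˡ-⊕; *-identityʳ to ⊗-identityʳ)

  module ⊕ = CommutativeSemigroupProperties
    (CommutativeSemiring.+-commutativeSemigroup S∞-commutativeSemiring)
  module ⊗ = CommutativeSemigroupProperties
    (CommutativeSemiring.*-commutativeSemigroup S∞-commutativeSemiring)

  x⊗y≼x : (P Q : S∞ n) → (P ⊗ Q) ≼ P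
  x⊗y≼x P Q = ⊗-≼-intro P Q λ {m₁} {m₂} m₁∈ _ →
    m₁ , m₁∈ , Absorbs-trans (m₂-absorbs-m₁·m₂ m₂ m₁) (Absorbs-reflexive (·m-comm m₂ m₁))

  ^∞-⊕ : (P Q : S∞ n) → (P ⊕ Q) ^∞ ≈ P ^∞ ⊕ Q ^∞
  ^∞-⊕ P Q = Eq.reflexive (map-++ mon∞ P Q)

  x^∞≼x^∞⊗x : (P : S∞ n) → (P ^∞) ≼ (P ^∞ ⊗ P)
  x^∞≼x^∞⊗x P = ≼-intro λ m∈ → case ∈-map⁻ mon∞ m∈ of λ { (m , m∈P , refl) →
    mon∞ m ·m m , ∈-⊗⁺ (∈-map⁺ mon∞ m∈P) m∈P , Absorbs-reflexive (mon∞-·m-self m) }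

  -- A record rather than a synonym, so that its indices stay inferable (⊗ is not injective).
  infix 4 _≼[_]_
  record _≼[_]_ (P C Q : S∞ n) : Set where
    constructor ≼[]-intro
    field ≼[]-elim : (P ⊗ C) ≼ (Q ⊗ C)

  open _≼[_]_ public

  ⊕-mono-≼[] : {P₁ P₂ Q₁ Q₂ C : S∞ n} →
               P₁ ≼[ C ] Q₁ → P₂ ≼[ C ] Q₂ → P₁ ⊕ P₂ ≼[ C ] Q₁ ⊕ Q₂
  ⊕-mono-≼[] {P₁} {P₂} {Q₁} {Q₂} {C} (≼[]-intro P₁≼Q₁) (≼[]-intro P₂≼Q₂) = ≼[]-intro (begin
    (P₁ ⊕ P₂) ⊗ C    ≈⟨ ⊗-distribʳ-⊕ C P₁ P₂ ⟩
    P₁ ⊗ C ⊕ P₂ ⊗ C  ≤⟨ ⊕-mono P₁≼Q₁ P₂≼Q₂ ⟩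
    Q₁ ⊗ C ⊕ Q₂ ⊗ C  ≈⟨ ⊗-distribʳ-⊕ C Q₁ Q₂ ⟨
    (Q₁ ⊕ Q₂) ⊗ C    ∎)
    where open PosetReasoning ≼-poset

  ⊗-mono-≼[] : {P₁ P₂ Q₁ Q₂ C : S∞ n} →
               P₁ ≼[ C ] Q₁ → P₂ ≼[ C ] Q₂ → P₁ ⊗ P₂ ≼[ C ] Q₁ ⊗ Q₂
  ⊗-mono-≼[] {P₁} {P₂} {Q₁} {Q₂} {C} (≼[]-intro P₁≼Q₁) (≼[]-intro P₂≼Q₂) = ≼[]-intro (begin
    (P₁ ⊗ P₂) ⊗ C  ≈⟨ ⊗-assoc P₁ P₂ C ⟩
    P₁ ⊗ (P₂ ⊗ C)  ≤⟨ ⊗-monoʳ P₁ P₂≼Q₂ ⟩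
    P₁ ⊗ (Q₂ ⊗ C)  ≈⟨ ⊗.x∙yz≈y∙xz P₁ Q₂ C ⟩
    Q₂ ⊗ (P₁ ⊗ C)  ≤⟨ ⊗-monoʳ Q₂ P₁≼Q₁ ⟩
    Q₂ ⊗ (Q₁ ⊗ C)  ≈⟨ ⊗.x∙yz≈yx∙z Q₂ Q₁ C ⟩
    (Q₁ ⊗ Q₂) ⊗ C  ∎)
    where open PosetReasoning ≼-poset

  ^∞-mono-≼[] : {U V C : S∞ n} → U ≼[ C ] V → U ^∞ ≼[ C ] V ^∞
  ^∞-mono-≼[] {U} {V} {C} (≼[]-intro UC≼VC) = ≼[]-intro (⊗-≼-intro (U ^∞) C λ m∞∈ k∈ →
    case ∈-map⁻ mon∞ m∞∈ of λ { (m , m∈ , refl) → witness m∈ k∈ })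
    where
    witness : ∀ {m k} → m ∈ U → k ∈ C →
              ∃ λ w → w ∈ V ^∞ ⊗ C × w Absorbs (mon∞ m ·m k)
    witness {m} {k} m∈ k∈
      with maximal-above {_≲_ = λ x y → (mon∞ m ·m y) Absorbs (mon∞ m ·m x)}
             Absorbs-refl (flip Absorbs-trans) (λ x y → (mon∞ m ·m y) Absorbs? (mon∞ m ·m x)) k C
    ... | k₁ , k₁∈k∷C , k₁-absorbs-k , k₁-maximal
      with ≼-elim UC≼VC (∈-⊗⁺ m∈ (∈-∷⁺ʳ k∈ ⊆-refl k₁∈k∷C))
    ... | w , w∈ , w-absorbs-mk₁ with ∈-⊗⁻ V C w∈
    ... | v , k₂ , v∈ , k₂∈ , refl =
      mon∞ v ·m k₂ , ∈-⊗⁺ (∈-map⁺ mon∞ v∈) k₂∈ ,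
      Absorbs-trans (mon∞-transfer m w-absorbs-mk₁ k₁-absorbs-k₂) k₁-absorbs-k
      where
      k₁-absorbs-k₂ : (mon∞ m ·m k₁) Absorbs (mon∞ m ·m k₂)
      k₁-absorbs-k₂ = k₁-maximal k₂∈ (mon∞-·m-gain m w-absorbs-mk₁)

  ^∞-mono : {U V : S∞ n} → U ≼ V → (U ^∞) ≼ (V ^∞)
  ^∞-mono {U} {V} U≼V = begin
    U ^∞      ≈⟨ ⊗-identityʳ (U ^∞) ⟨
    U ^∞ ⊗ 𝟙  ≤⟨ ≼[]-elim (^∞-mono-≼[] {U} {V} {𝟙} (≼[]-intro (⊗-monoˡ 𝟙 U≼V))) ⟩
    V ^∞ ⊗ 𝟙  ≈⟨ ⊗-identityʳ (V ^∞) ⟩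
    V ^∞      ∎
    where open PosetReasoning ≼-poset

  ^∞-cong : {U V : S∞ n} → U ≈ V → U ^∞ ≈ V ^∞
  ^∞-cong (U≼V , V≼U) = ^∞-mono U≼V , ^∞-mono V≼U

module _ {n : ℕ} (X : Fin n) (ρ : Fin n → S∞ n) (Q : Expr n) where

  private
    s ds sd : Expr n → S∞ n
    s P  = eval ρ (substE X Q P)
    ds P = eval ρ (∂ X (substE X Q P))
    sd P = eval ρ (substE X Q (∂ X P))
    D : S∞ n
    D = eval ρ (∂ X Q)

  open PosetReasoning (≼-poset {n})

  chain-rule : ∀ P →
    eval ρ (∂ X (substE X Q P)) ≈ eval ρ (substE X Q (∂ X P)) ⊗ eval ρ (∂ X Q)
  chain-rule (var Y) with Y ≟ X
  ... | yes _ = Eq.sym (⊗-identityˡ (eval ρ (∂ X Q)))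
  ... | no Y≢X with Y ≟ X   -- the substitution exposed a fresh ∂ X (var Y)
  ...   | yes Y≡X = contradiction Y≡X Y≢X
  ...   | no _    = Eq.refl
  chain-rule zero = Eq.refl
  chain-rule one  = Eq.refl
  chain-rule (P +ₑ R) = begin-equality
    ds P ⊕ ds R          ≈⟨ ⊕-cong (chain-rule P) (chain-rule R) ⟩
    sd P ⊗ D ⊕ sd R ⊗ D  ≈⟨ ⊗-distribʳ-⊕ D (sd P) (sd R) ⟨
    (sd P ⊕ sd R) ⊗ D    ∎
  chain-rule (P *ₑ R) = begin-equality
    ds P ⊗ s R ⊕ s P ⊗ ds R              ≈⟨ ⊕-cong (⊗-congʳ (s R) (chain-rule P)) (⊗-congˡ (s P) (chain-rule R)) ⟩
    (sd P ⊗ D) ⊗ s R ⊕ s P ⊗ (sd R ⊗ D)  ≈⟨ ⊕-cong (⊗.xy∙z≈xz∙y (sd P) (s R) D) (⊗-assoc (s P) (sd R) D) ⟨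
    (sd P ⊗ s R) ⊗ D ⊕ (s P ⊗ sd R) ⊗ D  ≈⟨ ⊗-distribʳ-⊕ D (sd P ⊗ s R) (s P ⊗ sd R) ⟨
    (sd P ⊗ s R ⊕ s P ⊗ sd R) ⊗ D        ∎
  chain-rule (P ^∞ₑ) = begin-equality
    s P ^∞ ⊗ ds P        ≈⟨ ⊗-congˡ (s P ^∞) (chain-rule P) ⟩
    s P ^∞ ⊗ (sd P ⊗ D)  ≈⟨ ⊗-assoc (s P ^∞) (sd P) D ⟨
    (s P ^∞ ⊗ sd P) ⊗ D  ∎

module _ {n : ℕ} {b : S∞ n} where

  open PosetReasoning (≼-poset {n})

  taylor-⊕ : (a₁ d₁ a₂ d₂ : S∞ n) {s₁ s₂ : S∞ n} → s₁ ≈ a₁ ⊕ d₁ ⊗ b → s₂ ≈ a₂ ⊕ d₂ ⊗ b →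
             s₁ ⊕ s₂ ≈ (a₁ ⊕ a₂) ⊕ (d₁ ⊕ d₂) ⊗ b
  taylor-⊕ a₁ d₁ a₂ d₂ {s₁} {s₂} s₁≈ s₂≈ = begin-equality
    s₁ ⊕ s₂                        ≈⟨ ⊕-cong s₁≈ s₂≈ ⟩
    (a₁ ⊕ d₁ ⊗ b) ⊕ (a₂ ⊕ d₂ ⊗ b)  ≈⟨ ⊕.interchange a₁ (d₁ ⊗ b) a₂ (d₂ ⊗ b) ⟩
    (a₁ ⊕ a₂) ⊕ (d₁ ⊗ b ⊕ d₂ ⊗ b)  ≈⟨ ⊕-congˡ (a₁ ⊕ a₂) (⊗-distribʳ-⊕ b d₁ d₂) ⟨
    (a₁ ⊕ a₂) ⊕ (d₁ ⊕ d₂) ⊗ b      ∎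

  taylor-⊗ : (a₁ d₁ a₂ d₂ : S∞ n) {s₁ s₂ : S∞ n} → s₁ ≈ a₁ ⊕ d₁ ⊗ b → s₂ ≈ a₂ ⊕ d₂ ⊗ b →
             s₁ ⊗ s₂ ≈ a₁ ⊗ a₂ ⊕ (d₁ ⊗ s₂ ⊕ s₁ ⊗ d₂) ⊗ b
  taylor-⊗ a₁ d₁ a₂ d₂ {s₁} {s₂} s₁≈ s₂≈ = upper , lower
    where
    a₁≼s₁ : a₁ ≼ s₁
    a₁≼s₁ = ≈⊕⇒≼ˡ a₁ (d₁ ⊗ b) s₁≈
    a₂≼s₂ : a₂ ≼ s₂
    a₂≼s₂ = ≈⊕⇒≼ˡ a₂ (d₂ ⊗ b) s₂≈
    d₁b≼s₁ : (d₁ ⊗ b) ≼ s₁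
    d₁b≼s₁ = ≈⊕⇒≼ʳ a₁ (d₁ ⊗ b) s₁≈
    d₂b≼s₂ : (d₂ ⊗ b) ≼ s₂
    d₂b≼s₂ = ≈⊕⇒≼ʳ a₂ (d₂ ⊗ b) s₂≈
    e₁ e₂ : S∞ n
    e₁ = (d₁ ⊗ s₂) ⊗ b
    e₂ = (s₁ ⊗ d₂) ⊗ b
    upper : (s₁ ⊗ s₂) ≼ (a₁ ⊗ a₂ ⊕ (d₁ ⊗ s₂ ⊕ s₁ ⊗ d₂) ⊗ b)
    upper = begin
      s₁ ⊗ s₂                            ≈⟨ ⊗-congʳ s₂ s₁≈ ⟩
      (a₁ ⊕ d₁ ⊗ b) ⊗ s₂                 ≈⟨ ⊗-distribʳ-⊕ s₂ a₁ (d₁ ⊗ b) ⟩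
      a₁ ⊗ s₂ ⊕ (d₁ ⊗ b) ⊗ s₂            ≈⟨ ⊕-cong (⊗-congˡ a₁ s₂≈) (⊗.xy∙z≈xz∙y d₁ b s₂) ⟩
      a₁ ⊗ (a₂ ⊕ d₂ ⊗ b) ⊕ e₁            ≈⟨ ⊕-congʳ e₁ (⊗-distribˡ-⊕ a₁ a₂ (d₂ ⊗ b)) ⟩
      (a₁ ⊗ a₂ ⊕ a₁ ⊗ (d₂ ⊗ b)) ⊕ e₁     ≈⟨ ⊕-congʳ e₁ (⊕-congˡ (a₁ ⊗ a₂) (⊗-assoc a₁ d₂ b)) ⟨
      (a₁ ⊗ a₂ ⊕ (a₁ ⊗ d₂) ⊗ b) ⊕ e₁     ≤⟨ ⊕-monoˡ e₁ (⊕-monoʳ (a₁ ⊗ a₂) (⊗-monoˡ b (⊗-monoˡ d₂ a₁≼s₁))) ⟩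
      (a₁ ⊗ a₂ ⊕ e₂) ⊕ e₁                ≈⟨ ⊕.xy∙z≈x∙zy (a₁ ⊗ a₂) e₂ e₁ ⟩
      a₁ ⊗ a₂ ⊕ (e₁ ⊕ e₂)                ≈⟨ ⊕-congˡ (a₁ ⊗ a₂) (⊗-distribʳ-⊕ b (d₁ ⊗ s₂) (s₁ ⊗ d₂)) ⟨
      a₁ ⊗ a₂ ⊕ (d₁ ⊗ s₂ ⊕ s₁ ⊗ d₂) ⊗ b  ∎
    lower : (a₁ ⊗ a₂ ⊕ (d₁ ⊗ s₂ ⊕ s₁ ⊗ d₂) ⊗ b) ≼ (s₁ ⊗ s₂)
    lower = ⊕-lub (⊗-mono a₁≼s₁ a₂≼s₂) (begin
      (d₁ ⊗ s₂ ⊕ s₁ ⊗ d₂) ⊗ b        ≈⟨ ⊗-distribʳ-⊕ b (d₁ ⊗ s₂) (s₁ ⊗ d₂) ⟩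
      e₁ ⊕ e₂                        ≈⟨ ⊕-cong (⊗.xy∙z≈xz∙y d₁ s₂ b) (⊗-assoc s₁ d₂ b) ⟩
      (d₁ ⊗ b) ⊗ s₂ ⊕ s₁ ⊗ (d₂ ⊗ b)  ≤⟨ ⊕-lub (⊗-monoˡ s₂ d₁b≼s₁) (⊗-monoʳ s₁ d₂b≼s₂) ⟩
      s₁ ⊗ s₂                        ∎)

  taylor-^∞ : (a d : S∞ n) {s : S∞ n} → s ≈ a ⊕ d ⊗ b → s ^∞ ≈ a ^∞ ⊕ (s ^∞ ⊗ d) ⊗ b
  taylor-^∞ a d {s} s≈ = upper , lower
    where
    a≼s : a ≼ s
    a≼s = ≈⊕⇒≼ˡ a (d ⊗ b) s≈
    db≼s : (d ⊗ b) ≼ s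
    db≼s = ≈⊕⇒≼ʳ a (d ⊗ b) s≈
    upper : (s ^∞) ≼ (a ^∞ ⊕ (s ^∞ ⊗ d) ⊗ b)
    upper = begin
      s ^∞                         ≈⟨ ^∞-cong s≈ ⟩
      (a ⊕ d ⊗ b) ^∞               ≈⟨ ^∞-⊕ a (d ⊗ b) ⟩
      a ^∞ ⊕ (d ⊗ b) ^∞            ≤⟨ ⊕-monoʳ (a ^∞) (x^∞≼x^∞⊗x (d ⊗ b)) ⟩
      a ^∞ ⊕ (d ⊗ b) ^∞ ⊗ (d ⊗ b)  ≤⟨ ⊕-monoʳ (a ^∞) (⊗-monoˡ (d ⊗ b) (^∞-mono db≼s)) ⟩
      a ^∞ ⊕ s ^∞ ⊗ (d ⊗ b)        ≈⟨ ⊕-congˡ (a ^∞) (⊗-assoc (s ^∞) d b) ⟨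
      a ^∞ ⊕ (s ^∞ ⊗ d) ⊗ b        ∎
    lower : (a ^∞ ⊕ (s ^∞ ⊗ d) ⊗ b) ≼ (s ^∞)
    lower = ⊕-lub (^∞-mono a≼s) (≼-trans (x⊗y≼x (s ^∞ ⊗ d) b) (x⊗y≼x (s ^∞) d))

module _ {n : ℕ} (X : Fin n) (b : S∞ n) (ρ₁ ρ₂ : Fin n → S∞ n) where

  private
    A D : Expr n → S∞ n
    A P = eval ρ₁ P
    D P = eval ρ₂ (∂ X P)

  TaylorExpansion : Expr n → Set
  TaylorExpansion P = eval ρ₂ P ≈ eval ρ₁ P ⊕ eval ρ₂ (∂ X P) ⊗ b

  taylor : (∀ Y → TaylorExpansion (var Y)) → ∀ P → TaylorExpansion P
  taylor expand-var (var Y)  = expand-var Y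
  taylor expand-var zero     = Eq.refl
  taylor expand-var one      = Eq.refl
  taylor expand-var (P +ₑ R) =
    taylor-⊕ (A P) (D P) (A R) (D R) (taylor expand-var P) (taylor expand-var R)
  taylor expand-var (P *ₑ R) =
    taylor-⊗ (A P) (D P) (A R) (D R) (taylor expand-var P) (taylor expand-var R)
  taylor expand-var (P ^∞ₑ)  = taylor-^∞ (A P) (D P) (taylor expand-var P)

module _ {n : ℕ} (C : S∞ n) (ρ₁ ρ₂ : Fin n → S∞ n) where

  eval-mono-≼[] : (∀ Y → ρ₁ Y ≼[ C ] ρ₂ Y) → ∀ P → eval ρ₁ P ≼[ C ] eval ρ₂ P
  eval-mono-≼[] var-≼ (var Y)  = var-≼ Y
  eval-mono-≼[] var-≼ zero     = ≼[]-intro ≼-refl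
  eval-mono-≼[] var-≼ one      = ≼[]-intro ≼-refl
  eval-mono-≼[] var-≼ (P +ₑ R) = ⊕-mono-≼[] (eval-mono-≼[] var-≼ P) (eval-mono-≼[] var-≼ R)
  eval-mono-≼[] var-≼ (P *ₑ R) = ⊗-mono-≼[] (eval-mono-≼[] var-≼ P) (eval-mono-≼[] var-≼ R)
  eval-mono-≼[] var-≼ (P ^∞ₑ)  = ^∞-mono-≼[] (eval-mono-≼[] var-≼ P)

lemma32 : ∀ {n} (X : Fin n) (P Q : Expr n) (a b c : S∞ n) →
    (⟦ ∂ X (substE X Q P) ⟧ ≈ ⟦ substE X Q (∂ X P) ⟧ ⊗ ⟦ ∂ X Q ⟧)
    × (P [ X ≔ a ⊕ b ] ≈ P [ X ≔ a ] ⊕ (∂ X P) [ X ≔ a ⊕ b ] ⊗ b)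
    × (a ⊗ c ≤ b ⊗ c → P [ X ≔ a ] ⊗ c ≤ P [ X ≔ b ] ⊗ c)
lemma32 {n} X P Q a b c =
  chain-rule X varS Q P ,
  taylor X b (X≔ a) (X≔ (a ⊕ b)) expand-var P ,
  λ ac≤bc → ≼⇒≤ (≼[]-elim (eval-mono-≼[] c (X≔ a) (X≔ b) (var-≼ (≼[]-intro (≤⇒≼ ac≤bc))) P))
  where
  X≔ : S∞ n → Fin n → S∞ n
  X≔ a Y = var Y [ X ≔ a ]

  expand-var : ∀ Y → TaylorExpansion X b (X≔ a) (X≔ (a ⊕ b)) (var Y)
  expand-var Y with Y ≟ X
  ... | yes _ = ⊕-congˡ a (Eq.sym (⊗-identityˡ b))
  ... | no _  = Eq.refl

  var-≼ : a ≼[ c ] b → ∀ Y → X≔ a Y ≼[ c ] X≔ b Y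
  var-≼ ac≼bc Y with Y ≟ X
  ... | yes _ = ac≼bc
  ... | no _  = ≼[]-intro ≼-refl
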